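{- For all $n\geq1$, $$\sum_{i=1}^{2n-1}P_{2i}+P_{4n-1}=B_{n}^{neobc}+R_{n}^{neobc}.$$
   Context: Pell numbers: $P_0=0$, $P_1=1$, $P_k=2P_{k-1}+P_{k-2}$. A positive integer $m$ is a neo balcobalancing number if there is a positive integer $r$ (its neo balcobalancer) such that $(1+2+\cdots+(m-1))+(1+2+\cdots+m)=2[(m-1)+m+(m+1)+(m+2)+\cdots+(m+r)]$; then $r=\frac{ -2m-1+\sqrt{8m^2-12m+9}}{2}$. $B_n^{neobc}$ denotes the $n$-th neo balcobalancing number in increasing order ($n\ge1$) and $R_n^{neobc}$ its neo balcobalancer. -}

module Defs where

open import Data.Nat using (ℕ; zero; suc; _+_; _*_; _∸_; _<_; _≤_)
open import Data.Product using (_×_; ∃)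
open import Relation.Binary.PropositionalEquality using (_≡_)

P : ℕ → ℕ
P zero = zero
P (suc zero) = suc zero
P (suc (suc k)) = 2 * P (suc k) + P k

sumFrom : (ℕ → ℕ) → ℕ → ℕ → ℕ
sumFrom f a zero = zero
sumFrom f a (suc k) = f a + sumFrom f (suc a) k

-- Σ_{i=a}^{b} f i  (empty, i.e. 0, when b < a)
Σ[_to_] : ℕ → ℕ → (ℕ → ℕ) → ℕ
Σ[ a to b ] f = sumFrom f a (suc b ∸ a)

idℕ : ℕ → ℕ
idℕ k = k

NeoBalcobalancer : ℕ → ℕ → Set
NeoBalcobalancer m r =
  (0 < m) × (0 < r) ×
  (Σ[ 1 to m ∸ 1 ] idℕ + Σ[ 1 to m ] idℕ ≡ 2 * Σ[ m ∸ 1 to m + r ] idℕ)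

NeoBalcobalancing : ℕ → Set
NeoBalcobalancing m = ∃ λ r → NeoBalcobalancer m r

IsNeoBCEnumeration : (ℕ → ℕ) → Set
IsNeoBCEnumeration B =
  (∀ n → 1 ≤ n → B n < B (suc n)) ×
  (∀ n → 1 ≤ n → NeoBalcobalancing (B n)) ×
  (∀ m → NeoBalcobalancing m → ∃ λ n → 1 ≤ n × B n ≡ m)

-- With x = 4m − 3 and y = 2m + 2r + 1 the neo balcobalancing condition
-- m² = (r + 2)(2m + r − 1) becomes x² + 9 = 2y².  The automorphism
-- T(u, v) = (3u + 4v, 2u + 3v) of x² − 2y² preserves this equation, and on a
-- solution with 4y ≤ 3x its inverse gives a smaller one; by descent every
-- solution is Tᵏ(3, 3) = (3(P₂ₖ + P₂ₖ₊₁), 3P₂ₖ₊₁).  T flips x between 3 and 1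
-- mod 4, so the neo balcobalancing numbers come from the odd k = 2n − 1, where
-- 2(Bₙ + Rₙ) + 1 = y = 3P₄ₙ₋₁; two strictly increasing enumerations of the same
-- set agree, which pins down the indexing.  On the other side
-- 2(P₂ + P₄ + ⋯ + P₂ₖ) + 1 = P₂ₖ₊₁, so the left-hand side also satisfies
-- 2·LHS + 1 = P₄ₙ₋₁ + 2P₄ₙ₋₁ = 3P₄ₙ₋₁.

module Submission where

open import Defs
open import Data.Nat using (ℕ; zero; suc; _+_; _*_; _∸_; _≤_; _<_; _%_; s≤s; z<s; _≤?_; _≟_; allUpTo?)
open import Data.Nat.Properties
open import Data.Nat.DivMod using ([m+kn]%n≡m%n)
open import Data.Nat.Induction using (<-rec)
open import Data.Nat.Tactic.RingSolver using (solve-∀)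
open import Data.Product using (_×_; _,_; ∃; ∃₂; proj₁; proj₂; map₂)
open import Data.Sum using (_⊎_; inj₁; inj₂)
open import Function.Bundles using (_⇔_; mk⇔; Equivalence)
open import Relation.Binary.Definitions using (tri<; tri≈; tri>)
open import Relation.Binary.PropositionalEquality
open import Relation.Nullary using (yes; no; contradiction)
open import Relation.Nullary.Decidable using (toWitness; _×-dec_; _→-dec_)

a+d≡b+c⇒a≡b⇔c≡d : ∀ {a b c d} → a + d ≡ b + c → (a ≡ b ⇔ c ≡ d)
a+d≡b+c⇒a≡b⇔c≡d {a} {b} {c} {d} eq = mk⇔
  (λ { refl → sym (+-cancelˡ-≡ a d c eq) })
  (λ { refl → +-cancelʳ-≡ d a b eq })

m*m≤n*n⇒m≤n : ∀ {m n} → m * m ≤ n * n → m ≤ n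
m*m≤n*n⇒m≤n m*m≤n*n = ≮⇒≥ λ n<m → <⇒≱ (*-mono-< n<m n<m) m*m≤n*n

m*m<n*n⇒m<n : ∀ {m n} → m * m < n * n → m < n
m*m<n*n⇒m<n m*m<n*n = ≰⇒> λ n≤m → <⇒≱ m*m<n*n (*-mono-≤ n≤m n≤m)

even-or-odd : ∀ k → (∃ λ j → k ≡ 2 * j) ⊎ (∃ λ j → k ≡ 1 + 2 * j)
even-or-odd zero = inj₁ (0 , refl)
even-or-odd (suc k) with even-or-odd k
... | inj₁ (j , refl) = inj₂ (j , refl)
... | inj₂ (j , refl) = inj₁ (suc j , sym (*-suc 2 j))

StrictlyIncreasing : (ℕ → ℕ) → Set
StrictlyIncreasing f = ∀ n → f n < f (suc n)

module _ {f : ℕ → ℕ} (f↑ : StrictlyIncreasing f) where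

  increasing⇒<-mono : ∀ {m n} → m < n → f m < f n
  increasing⇒<-mono {m} {suc n} m<1+n with m<1+n⇒m<n∨m≡n m<1+n
  ... | inj₁ m<n  = <-trans (increasing⇒<-mono m<n) (f↑ n)
  ... | inj₂ refl = f↑ m

  increasing⇒<-reflect : ∀ {m n} → f m < f n → m < n
  increasing⇒<-reflect {m} {n} fm<fn with <-cmp m n
  ... | tri< m<n _ _  = m<n
  ... | tri≈ _ refl _ = contradiction fm<fn (<-irrefl refl)
  ... | tri> _ _ n<m  = contradiction fm<fn (<-asym (increasing⇒<-mono n<m))

  increasing⇒injective : ∀ {m n} → f m ≡ f n → m ≡ n
  increasing⇒injective fm≡fn = ≤-antisym
    (≮⇒≥ λ n<m → <-irrefl (sym fm≡fn) (increasing⇒<-mono n<m))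
    (≮⇒≥ λ m<n → <-irrefl fm≡fn (increasing⇒<-mono m<n))

increasing-enumerations-agree : ∀ {f g} → StrictlyIncreasing f → StrictlyIncreasing g →
  (∀ n → ∃ λ m → f n ≡ g m) → (∀ m → ∃ λ n → g m ≡ f n) → ∀ n → f n ≡ g n
increasing-enumerations-agree {f} {g} f↑ g↑ f⊆g g⊆f = <-rec _ agree
  where
  agree : ∀ n → (∀ {i} → i < n → f i ≡ g i) → f n ≡ g n
  agree n ih with f⊆g n | g⊆f n
  ... | m , fn≡gm | n′ , gn≡fn′ with <-cmp m n
  ... | tri≈ _ refl _ = fn≡gm
  ... | tri< m<n _ _  =
    contradiction (increasing⇒injective f↑ (trans (ih m<n) (sym fn≡gm))) (<⇒≢ m<n)
  ... | tri> _ _ n<m  =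
    contradiction (increasing⇒injective g↑ (trans gn≡fn′ (ih n′<n))) (>⇒≢ n′<n)
    where
    n′<n : n′ < n
    n′<n = increasing⇒<-reflect f↑ (subst₂ _<_ gn≡fn′ (sym fn≡gm) (increasing⇒<-mono g↑ n<m))

sumFrom-idℕ : ∀ a k → 2 * sumFrom idℕ a k + k ≡ k * (2 * a + k)
sumFrom-idℕ a zero    = refl
sumFrom-idℕ a (suc k) = begin
  2 * (a + s) + suc k              ≡⟨ split a s k ⟩
  (2 * a + 1) + (2 * s + k)        ≡⟨ cong (2 * a + 1 +_) (sumFrom-idℕ (suc a) k) ⟩
  (2 * a + 1) + k * (2 * suc a + k) ≡⟨ merge a k ⟩
  suc k * (2 * a + suc k)          ∎
  where
  open ≡-Reasoning
  s = sumFrom idℕ (suc a) k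
  split : ∀ a s k → 2 * (a + s) + suc k ≡ (2 * a + 1) + (2 * s + k)
  split = solve-∀
  merge : ∀ a k → (2 * a + 1) + k * (2 * suc a + k) ≡ suc k * (2 * a + suc k)
  merge = solve-∀

triangle+triangle≡square : ∀ m → Σ[ 1 to m ] idℕ + Σ[ 1 to suc m ] idℕ ≡ suc m * suc m
triangle+triangle≡square m = *-cancelˡ-≡ _ _ 2 (+-cancelʳ-≡ (2 * m + 1) _ _ (begin
  2 * (s + t) + (2 * m + 1)                  ≡⟨ split s t m ⟩
  (2 * s + m) + (2 * t + suc m)              ≡⟨ cong₂ _+_ (sumFrom-idℕ 1 m) (sumFrom-idℕ 1 (suc m)) ⟩
  m * (2 + m) + suc m * (2 + suc m)          ≡⟨ merge m ⟩
  2 * (suc m * suc m) + (2 * m + 1)          ∎))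
  where
  open ≡-Reasoning
  s = sumFrom idℕ 1 m
  t = sumFrom idℕ 1 (suc m)
  split : ∀ s t m → 2 * (s + t) + (2 * m + 1) ≡ (2 * s + m) + (2 * t + suc m)
  split = solve-∀
  merge : ∀ m → m * (2 + m) + suc m * (2 + suc m) ≡ 2 * (suc m * suc m) + (2 * m + 1)
  merge = solve-∀

window-sum : ∀ m r → 2 * Σ[ m to suc m + r ] idℕ ≡ (2 + r) * (2 * m + r + 1)
window-sum m r = begin
  2 * Σ[ m to suc m + r ] idℕ   ≡⟨ cong (λ k → 2 * sumFrom idℕ m k) length ⟩
  2 * sumFrom idℕ m (2 + r)     ≡⟨ +-cancelʳ-≡ (2 + r) _ _ (trans (sumFrom-idℕ m (2 + r)) (split m r)) ⟩
  (2 + r) * (2 * m + r + 1)     ∎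
  where
  open ≡-Reasoning
  length : suc (suc m + r) ∸ m ≡ 2 + r
  length = trans (cong (_∸ m) (sym (trans (+-suc m (suc r)) (cong suc (+-suc m r)))))
                 (m+n∸m≡n m (2 + r))
  split : ∀ m r → (2 + r) * (2 * m + (2 + r)) ≡ (2 + r) * (2 * m + r + 1) + (2 + r)
  split = solve-∀

NegPell : ℕ → ℕ → Set
NegPell x y = x * x + 9 ≡ 2 * (y * y)

NegPell-step⇔ : ∀ u v → NegPell (3 * u + 4 * v) (2 * u + 3 * v) ⇔ NegPell u v
NegPell-step⇔ u v = a+d≡b+c⇒a≡b⇔c≡d (identity u v)
  where
  identity : ∀ u v → (3 * u + 4 * v) * (3 * u + 4 * v) + 9 + 2 * (v * v)
                   ≡ 2 * ((2 * u + 3 * v) * (2 * u + 3 * v)) + (u * u + 9)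
  identity = solve-∀

square≡product⇔NegPell : ∀ m r →
  (suc m * suc m ≡ (2 + r) * (2 * m + r + 1)) ⇔ NegPell (4 * m + 1) (2 * m + 2 * r + 3)
square≡product⇔NegPell m r = mk⇔
  (λ eq → from (cong (8 *_) eq))
  (λ sol → *-cancelˡ-≡ _ _ 8 (to sol))
  where
  identity : ∀ m r → (4 * m + 1) * (4 * m + 1) + 9 + 8 * ((2 + r) * (2 * m + r + 1))
                   ≡ 2 * ((2 * m + 2 * r + 3) * (2 * m + 2 * r + 3)) + 8 * (suc m * suc m)
  identity = solve-∀
  scaled : NegPell (4 * m + 1) (2 * m + 2 * r + 3)
         ⇔ (8 * (suc m * suc m) ≡ 8 * ((2 + r) * (2 * m + r + 1)))
  scaled = a+d≡b+c⇒a≡b⇔c≡d (identity m r)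
  open Equivalence scaled

neoBalcobalancer⇔NegPell : ∀ m r →
  NeoBalcobalancer (suc m) r ⇔ (0 < r × NegPell (4 * m + 1) (2 * m + 2 * r + 3))
neoBalcobalancer⇔NegPell m r = mk⇔
  (λ (_ , r>0 , eq) → r>0 ,
     to (trans (sym (triangle+triangle≡square m)) (trans eq (window-sum m r))))
  (λ (r>0 , sol) → z<s , r>0 ,
     trans (triangle+triangle≡square m) (trans (from sol) (sym (window-sum m r))))
  where open Equivalence (square≡product⇔NegPell m r)

mutual
  X : ℕ → ℕ
  X zero    = 3
  X (suc k) = 3 * X k + 4 * Y k

  Y : ℕ → ℕ
  Y zero    = 3
  Y (suc k) = 2 * X k + 3 * Y k

OnOrbit : ℕ → ℕ → Set
OnOrbit x y = ∃ λ k → x ≡ X k × y ≡ Y k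

orbit-solves : ∀ k → NegPell (X k) (Y k)
orbit-solves zero    = refl
orbit-solves (suc k) = Equivalence.from (NegPell-step⇔ (X k) (Y k)) (orbit-solves k)

step-inverse : ∀ {x y u v} → 4 * y + u ≡ 3 * x → 2 * x + v ≡ 3 * y →
               x ≡ 3 * u + 4 * v × y ≡ 2 * u + 3 * v
step-inverse {x} {y} {u} {v} eu ev =
    +-cancelʳ-≡ (8 * x + 12 * y) x (3 * u + 4 * v) (begin
      x + (8 * x + 12 * y)              ≡⟨ x-side x y ⟩
      3 * (3 * x) + 4 * (3 * y)         ≡⟨ cong₂ (λ p q → 3 * p + 4 * q) (sym eu) (sym ev) ⟩
      3 * (4 * y + u) + 4 * (2 * x + v) ≡⟨ u-side x y u v ⟩
      3 * u + 4 * v + (8 * x + 12 * y)  ∎)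
  , +-cancelʳ-≡ (6 * x + 8 * y) y (2 * u + 3 * v) (begin
      y + (6 * x + 8 * y)               ≡⟨ y-side x y ⟩
      2 * (3 * x) + 3 * (3 * y)         ≡⟨ cong₂ (λ p q → 2 * p + 3 * q) (sym eu) (sym ev) ⟩
      2 * (4 * y + u) + 3 * (2 * x + v) ≡⟨ v-side x y u v ⟩
      2 * u + 3 * v + (6 * x + 8 * y)   ∎)
  where
  open ≡-Reasoning
  x-side : ∀ x y → x + (8 * x + 12 * y) ≡ 3 * (3 * x) + 4 * (3 * y)
  x-side = solve-∀
  u-side : ∀ x y u v → 3 * (4 * y + u) + 4 * (2 * x + v) ≡ 3 * u + 4 * v + (8 * x + 12 * y)
  u-side = solve-∀
  y-side : ∀ x y → y + (6 * x + 8 * y) ≡ 2 * (3 * x) + 3 * (3 * y)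
  y-side = solve-∀
  v-side : ∀ x y u v → 2 * (4 * y + u) + 3 * (2 * x + v) ≡ 2 * u + 3 * v + (6 * x + 8 * y)
  v-side = solve-∀

NegPell-descent : ∀ {x y} → NegPell x y → 4 * y ≤ 3 * x →
                  ∃₂ λ u v → x ≡ 3 * u + 4 * v × y ≡ 2 * u + 3 * v
NegPell-descent {x} {y} sol 4y≤3x =
  3 * x ∸ 4 * y , 3 * y ∸ 2 * x , step-inverse (m+[n∸m]≡n 4y≤3x) (m+[n∸m]≡n 2x≤3y)
  where
  open ≤-Reasoning
  2x≤3y : 2 * x ≤ 3 * y
  2x≤3y = m*m≤n*n⇒m≤n (*-cancelˡ-≤ 2 (begin
    2 * ((2 * x) * (2 * x))  ≡⟨ lhs x ⟩
    8 * (x * x)              ≤⟨ m≤m+n _ _ ⟩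
    8 * (x * x) + (x * x + 81) ≡⟨ mid x ⟩
    9 * (x * x + 9)          ≡⟨ cong (9 *_) sol ⟩
    9 * (2 * (y * y))        ≡⟨ rhs y ⟩
    2 * ((3 * y) * (3 * y))  ∎))
    where
    lhs : ∀ x → 2 * ((2 * x) * (2 * x)) ≡ 8 * (x * x)
    lhs = solve-∀
    mid : ∀ x → 8 * (x * x) + (x * x + 81) ≡ 9 * (x * x + 9)
    mid = solve-∀
    rhs : ∀ y → 9 * (2 * (y * y)) ≡ 2 * ((3 * y) * (3 * y))
    rhs = solve-∀

NegPell-base : ∀ {x y} → NegPell x y → 3 * x < 4 * y → x ≡ 3 × y ≡ 3
NegPell-base {x} {y} sol 3x<4y = finite-check x<9 y<7 sol
  where
  open ≤-Reasoning
  finite-check : ∀ {a} → a < 9 → ∀ {b} → b < 7 → NegPell a b → a ≡ 3 × b ≡ 3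
  finite-check = toWitness {a? = allUpTo? (λ a → allUpTo? (λ b →
    (a * a + 9 ≟ 2 * (b * b)) →-dec (a ≟ 3 ×-dec b ≟ 3)) 7) 9} _
  x*x<72 : x * x < 72
  x*x<72 = +-cancelˡ-< (8 * (x * x)) (x * x) 72 (begin-strict
    8 * (x * x) + x * x      ≡⟨ lhs x ⟩
    (3 * x) * (3 * x)        <⟨ *-mono-< 3x<4y 3x<4y ⟩
    (4 * y) * (4 * y)        ≡⟨ mid y ⟩
    8 * (2 * (y * y))        ≡⟨ cong (8 *_) sol ⟨
    8 * (x * x + 9)          ≡⟨ rhs x ⟩
    8 * (x * x) + 72         ∎)
    where
    lhs : ∀ x → 8 * (x * x) + x * x ≡ (3 * x) * (3 * x)
    lhs = solve-∀
    mid : ∀ y → (4 * y) * (4 * y) ≡ 8 * (2 * (y * y))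
    mid = solve-∀
    rhs : ∀ x → 8 * (x * x + 9) ≡ 8 * (x * x) + 72
    rhs = solve-∀
  x<9 : x < 9
  x<9 = m*m<n*n⇒m<n (<-trans x*x<72 (m<m+n 72 z<s))
  y<7 : y < 7
  y<7 = m*m<n*n⇒m<n (*-cancelˡ-< 2 (y * y) 49 (begin-strict
    2 * (y * y)  ≡⟨ sol ⟨
    x * x + 9    <⟨ +-monoˡ-< 9 x*x<72 ⟩
    81           ≤⟨ m≤m+n 81 17 ⟩
    98           ∎))

NegPell⇒orbit : ∀ {x y} → NegPell x y → OnOrbit x y
NegPell⇒orbit {x} = <-rec (λ x → ∀ {y} → NegPell x y → OnOrbit x y) descend x
  where
  u<3u+4v : ∀ {u v} → NegPell u v → u < 3 * u + 4 * v
  u<3u+4v {u} {zero}  sol = contradiction (trans (+-comm 9 (u * u)) sol) λ ()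
  u<3u+4v {u} {suc v} _   = <-≤-trans (m<m+n u z<s) (+-monoˡ-≤ (4 * suc v) (m≤n*m u 3))

  descend : ∀ x → (∀ {x′} → x′ < x → ∀ {y} → NegPell x′ y → OnOrbit x′ y) →
            ∀ {y} → NegPell x y → OnOrbit x y
  descend x ih {y} sol with 4 * y ≤? 3 * x
  ... | no 4y≰3x = 0 , NegPell-base sol (≰⇒> 4y≰3x)
  ... | yes 4y≤3x = lift (NegPell-descent sol 4y≤3x)
    where
    lift : (∃₂ λ u v → x ≡ 3 * u + 4 * v × y ≡ 2 * u + 3 * v) → OnOrbit x y
    lift (u , v , x≡ , y≡) = extend (ih (subst (u <_) (sym x≡) (u<3u+4v {v = v} solᵤ)) {v} solᵤ)
      where
      solᵤ : NegPell u v
      solᵤ = Equivalence.to (NegPell-step⇔ u v) (subst₂ NegPell x≡ y≡ sol)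
      extend : OnOrbit u v → OnOrbit x y
      extend (k , u≡ , v≡) = suc k , trans x≡ (cong₂ (λ p q → 3 * p + 4 * q) u≡ v≡)
                                   , trans y≡ (cong₂ (λ p q → 2 * p + 3 * q) u≡ v≡)

X-suc-suc : ∀ k → X (suc (suc k)) ≡ X k + (4 * X k + 6 * Y k) * 4
X-suc-suc k = identity (X k) (Y k)
  where
  identity : ∀ a b → 3 * (3 * a + 4 * b) + 4 * (2 * a + 3 * b) ≡ a + (4 * a + 6 * b) * 4
  identity = solve-∀

X[2j]%4≡3 : ∀ j → X (2 * j) % 4 ≡ 3
X[2j]%4≡3 zero    = refl
X[2j]%4≡3 (suc j) = begin
  X (2 * suc j) % 4           ≡⟨ cong (λ k → X k % 4) (*-suc 2 j) ⟩
  X (2 + 2 * j) % 4           ≡⟨ cong (_% 4) (X-suc-suc (2 * j)) ⟩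
  (x + (4 * x + 6 * y) * 4) % 4 ≡⟨ [m+kn]%n≡m%n x (4 * x + 6 * y) 4 ⟩
  x % 4                       ≡⟨ X[2j]%4≡3 j ⟩
  3                           ∎
  where
  open ≡-Reasoning
  x = X (2 * j)
  y = Y (2 * j)

[4m+1]%4≡1 : ∀ m → (4 * m + 1) % 4 ≡ 1
[4m+1]%4≡1 m = trans (cong (_% 4) (trans (+-comm (4 * m) 1) (cong (1 +_) (*-comm 4 m))))
                     ([m+kn]%n≡m%n 1 m 4)

orbit-pell : ∀ k → Y k ≡ 3 * P (1 + 2 * k) × X k + Y k ≡ 3 * P (2 + 2 * k)
orbit-pell zero    = refl , refl
orbit-pell (suc k) =
  subst (λ i → Y (suc k) ≡ 3 * P (1 + i) × X (suc k) + Y (suc k) ≡ 3 * P (2 + i))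
        (sym (*-suc 2 k)) (y′ , x′+y′)
  where
  open ≡-Reasoning
  p = P (1 + 2 * k)
  q = P (2 + 2 * k)
  y≡ = proj₁ (orbit-pell k)
  x+y≡ = proj₂ (orbit-pell k)
  factor : ∀ a b → 2 * (3 * a) + 3 * b ≡ 3 * (2 * a + b)
  factor = solve-∀
  y′ : Y (suc k) ≡ 3 * P (3 + 2 * k)
  y′ = begin
    2 * X k + 3 * Y k       ≡⟨ regroup (X k) (Y k) ⟩
    2 * (X k + Y k) + Y k   ≡⟨ cong₂ (λ s t → 2 * s + t) x+y≡ y≡ ⟩
    2 * (3 * q) + 3 * p     ≡⟨ factor q p ⟩
    3 * P (3 + 2 * k)       ∎
    where
    regroup : ∀ a b → 2 * a + 3 * b ≡ 2 * (a + b) + b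
    regroup = solve-∀
  x′+y′ : X (suc k) + Y (suc k) ≡ 3 * P (4 + 2 * k)
  x′+y′ = begin
    (3 * X k + 4 * Y k) + (2 * X k + 3 * Y k) ≡⟨ regroup (X k) (Y k) ⟩
    2 * Y (suc k) + (X k + Y k)                ≡⟨ cong₂ (λ s t → 2 * s + t) y′ x+y≡ ⟩
    2 * (3 * P (3 + 2 * k)) + 3 * q            ≡⟨ factor (P (3 + 2 * k)) q ⟩
    3 * P (4 + 2 * k)                          ∎
    where
    regroup : ∀ a b → (3 * a + 4 * b) + (2 * a + 3 * b) ≡ 2 * (2 * a + 3 * b) + (a + b)
    regroup = solve-∀

sum-even-pell : ∀ a k →
  2 * sumFrom (λ i → P (2 * i)) (suc a) k + P (1 + 2 * a) ≡ P (1 + 2 * (a + k))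
sum-even-pell a zero    = cong (λ i → P (1 + 2 * i)) (sym (+-identityʳ a))
sum-even-pell a (suc k) = begin
  2 * (P (2 * suc a) + s) + P (1 + 2 * a)     ≡⟨ regroup (P (2 * suc a)) s (P (1 + 2 * a)) ⟩
  2 * s + (2 * P (2 * suc a) + P (1 + 2 * a)) ≡⟨ cong (2 * s +_) pell-recurrence ⟩
  2 * s + P (1 + 2 * suc a)                   ≡⟨ sum-even-pell (suc a) k ⟩
  P (1 + 2 * (suc a + k))                     ≡⟨ cong (λ i → P (1 + 2 * i)) (+-suc a k) ⟨
  P (1 + 2 * (a + suc k))                     ∎
  where
  open ≡-Reasoning
  s = sumFrom (λ i → P (2 * i)) (suc (suc a)) k
  regroup : ∀ p s q → 2 * (p + s) + q ≡ 2 * s + (2 * p + q)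
  regroup = solve-∀
  pell-recurrence : 2 * P (2 * suc a) + P (1 + 2 * a) ≡ P (1 + 2 * suc a)
  pell-recurrence = subst (λ i → 2 * P i + P (1 + 2 * a) ≡ P (1 + i)) (sym (*-suc 2 a)) refl

-- neoBC j and neoBCr j are the paper's B_{j+1} and R_{j+1}; neoBCpred j = neoBC j − 1.
-- The recursion is T² = [[17, 24], [12, 17]] acting on x = 4a + 1, y = 2a + 2r + 3,
-- rewritten in the coordinates (a, r).
mutual
  neoBCpred : ℕ → ℕ
  neoBCpred zero    = 5
  neoBCpred (suc j) = 29 * neoBCpred j + 12 * neoBCr j + 22

  neoBCr : ℕ → ℕ
  neoBCr zero    = 1
  neoBCr (suc j) = 12 * neoBCpred j + 5 * neoBCr j + 8

neoBC : ℕ → ℕ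
neoBC j = suc (neoBCpred j)

neoBCr-positive : ∀ j → 0 < neoBCr j
neoBCr-positive zero    = z<s
neoBCr-positive (suc j) = <-≤-trans z<s (m≤n+m 8 _)

neoBC-increasing : StrictlyIncreasing neoBC
neoBC-increasing j =
  s≤s (subst (neoBCpred j <_) (sym (expand (neoBCpred j) (neoBCr j))) (s≤s (m≤m+n _ _)))
  where
  expand : ∀ a r → 29 * a + 12 * r + 22 ≡ suc (a + (28 * a + 12 * r + 21))
  expand = solve-∀

orbit-odd : ∀ j → X (1 + 2 * j) ≡ 4 * neoBCpred j + 1
                × Y (1 + 2 * j) ≡ 2 * neoBCpred j + 2 * neoBCr j + 3
orbit-odd zero    = refl , refl
orbit-odd (suc j) =
  subst (λ i → X (1 + i) ≡ 4 * neoBCpred (suc j) + 1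
             × Y (1 + i) ≡ 2 * neoBCpred (suc j) + 2 * neoBCr (suc j) + 3)
        (sym (*-suc 2 j))
    ( trans (cong₂ (λ p q → 3 * (3 * p + 4 * q) + 4 * (2 * p + 3 * q)) x≡ y≡) (x-step a r)
    , trans (cong₂ (λ p q → 2 * (3 * p + 4 * q) + 3 * (2 * p + 3 * q)) x≡ y≡) (y-step a r))
  where
  a = neoBCpred j
  r = neoBCr j
  x≡ = proj₁ (orbit-odd j)
  y≡ = proj₂ (orbit-odd j)
  x-step : ∀ a r → 3 * (3 * (4 * a + 1) + 4 * (2 * a + 2 * r + 3))
                   + 4 * (2 * (4 * a + 1) + 3 * (2 * a + 2 * r + 3))
                 ≡ 4 * (29 * a + 12 * r + 22) + 1
  x-step = solve-∀
  y-step : ∀ a r → 2 * (3 * (4 * a + 1) + 4 * (2 * a + 2 * r + 3))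
                   + 3 * (2 * (4 * a + 1) + 3 * (2 * a + 2 * r + 3))
                 ≡ 2 * (29 * a + 12 * r + 22) + 2 * (12 * a + 5 * r + 8) + 3
  y-step = solve-∀

neoBalcobalancer-classification : ∀ {m r} → NeoBalcobalancer m r →
                                  ∃ λ j → m ≡ neoBC j × r ≡ neoBCr j
neoBalcobalancer-classification {zero}  (() , _)
neoBalcobalancer-classification {suc m} {r} bal = from-orbit (NegPell⇒orbit sol)
  where
  sol : NegPell (4 * m + 1) (2 * m + 2 * r + 3)
  sol = proj₂ (Equivalence.to (neoBalcobalancer⇔NegPell m r) bal)
  from-odd : ∀ j → 4 * m + 1 ≡ X (1 + 2 * j) → 2 * m + 2 * r + 3 ≡ Y (1 + 2 * j) →
             ∃ λ j → suc m ≡ neoBC j × r ≡ neoBCr j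
  from-odd j x≡ y≡ = j , cong suc m≡ , r≡
    where
    m≡ : m ≡ neoBCpred j
    m≡ = *-cancelˡ-≡ _ _ 4 (+-cancelʳ-≡ 1 _ _ (trans x≡ (proj₁ (orbit-odd j))))
    r≡ : r ≡ neoBCr j
    r≡ = *-cancelˡ-≡ _ _ 2 (+-cancelˡ-≡ (2 * m) _ _ (+-cancelʳ-≡ 3 _ _
           (trans y≡ (trans (proj₂ (orbit-odd j)) (cong (λ a → 2 * a + 2 * neoBCr j + 3) (sym m≡))))))
  from-orbit : OnOrbit (4 * m + 1) (2 * m + 2 * r + 3) → ∃ λ j → suc m ≡ neoBC j × r ≡ neoBCr j
  from-orbit (k , x≡ , y≡) with even-or-odd k
  ... | inj₁ (j , k≡2j)   = contradiction
    (trans (sym ([4m+1]%4≡1 m)) (trans (cong (_% 4) (trans x≡ (cong X k≡2j))) (X[2j]%4≡3 j))) λ ()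
  ... | inj₂ (j , k≡1+2j) = from-odd j (trans x≡ (cong X k≡1+2j)) (trans y≡ (cong Y k≡1+2j))

neoBC-balanced : ∀ j → NeoBalcobalancer (neoBC j) (neoBCr j)
neoBC-balanced j = Equivalence.from (neoBalcobalancer⇔NegPell (neoBCpred j) (neoBCr j))
  ( neoBCr-positive j
  , subst₂ NegPell (proj₁ (orbit-odd j)) (proj₂ (orbit-odd j)) (orbit-solves (1 + 2 * j)))

neoBC-balancer-unique : ∀ j {r} → NeoBalcobalancer (neoBC j) r → r ≡ neoBCr j
neoBC-balancer-unique j {r} bal = same-index (neoBalcobalancer-classification bal)
  where
  same-index : (∃ λ j′ → neoBC j ≡ neoBC j′ × r ≡ neoBCr j′) → r ≡ neoBCr j
  same-index (j′ , neoBC≡ , r≡) =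
    trans r≡ (cong neoBCr (sym (increasing⇒injective neoBC-increasing {j} {j′} neoBC≡)))

enumeration≡neoBC : ∀ {B} → IsNeoBCEnumeration B → ∀ j → B (suc j) ≡ neoBC j
enumeration≡neoBC {B} (B↑ , B-neo , B-onto) =
  increasing-enumerations-agree (λ n → B↑ (suc n) z<s) neoBC-increasing B⊆neoBC neoBC⊆B
  where
  B⊆neoBC : ∀ n → ∃ λ j → B (suc n) ≡ neoBC j
  B⊆neoBC n = map₂ proj₁ (neoBalcobalancer-classification (proj₂ (B-neo (suc n) z<s)))
  neoBC⊆B : ∀ j → ∃ λ n → neoBC j ≡ B (suc n)
  neoBC⊆B j = shift (B-onto (neoBC j) (neoBCr j , neoBC-balanced j))
    where
    shift : (∃ λ n → 1 ≤ n × B n ≡ neoBC j) → ∃ λ n → neoBC j ≡ B (suc n)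
    shift (suc n , _ , B≡) = n , sym B≡

1+2[1+2j]≡3+4j : ∀ j → 1 + 2 * (1 + 2 * j) ≡ 3 + 4 * j
1+2[1+2j]≡3+4j = solve-∀

pell-sum-identity : ∀ j →
  2 * (sumFrom (λ i → P (2 * i)) 1 (1 + 2 * j) + P (3 + 4 * j)) + 1 ≡ 3 * P (3 + 4 * j)
pell-sum-identity j = begin
  2 * (s + p) + 1                  ≡⟨ regroup s p ⟩
  (2 * s + 1) + 2 * p              ≡⟨ cong (_+ 2 * p) (sum-even-pell 0 (1 + 2 * j)) ⟩
  P (1 + 2 * (1 + 2 * j)) + 2 * p  ≡⟨ cong (λ i → P i + 2 * p) (1+2[1+2j]≡3+4j j) ⟩
  p + 2 * p                        ≡⟨ triple p ⟩
  3 * p                            ∎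
  where
  open ≡-Reasoning
  s = sumFrom (λ i → P (2 * i)) 1 (1 + 2 * j)
  p = P (3 + 4 * j)
  regroup : ∀ s p → 2 * (s + p) + 1 ≡ (2 * s + 1) + 2 * p
  regroup = solve-∀
  triple : ∀ p → p + 2 * p ≡ 3 * p
  triple = solve-∀

neoBC+neoBCr-identity : ∀ j → 2 * (neoBC j + neoBCr j) + 1 ≡ 3 * P (3 + 4 * j)
neoBC+neoBCr-identity j = begin
  2 * (suc a + r) + 1          ≡⟨ expand a r ⟩
  2 * a + 2 * r + 3            ≡⟨ proj₂ (orbit-odd j) ⟨
  Y (1 + 2 * j)                ≡⟨ proj₁ (orbit-pell (1 + 2 * j)) ⟩
  3 * P (1 + 2 * (1 + 2 * j))  ≡⟨ cong (λ i → 3 * P i) (1+2[1+2j]≡3+4j j) ⟩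
  3 * P (3 + 4 * j)            ∎
  where
  open ≡-Reasoning
  a = neoBCpred j
  r = neoBCr j
  expand : ∀ a r → 2 * (suc a + r) + 1 ≡ 2 * a + 2 * r + 3
  expand = solve-∀

pell-sum≡neoBC+neoBCr : ∀ j →
  sumFrom (λ i → P (2 * i)) 1 (1 + 2 * j) + P (3 + 4 * j) ≡ neoBC j + neoBCr j
pell-sum≡neoBC+neoBCr j = *-cancelˡ-≡ _ _ 2 (+-cancelʳ-≡ 1 _ _
  (trans (pell-sum-identity j) (sym (neoBC+neoBCr-identity j))))

theorem9p4 : (B : ℕ → ℕ) → IsNeoBCEnumeration B →
    (n : ℕ) → 1 ≤ n → (r : ℕ) → NeoBalcobalancer (B n) r →
    Σ[ 1 to 2 * n ∸ 1 ] (λ i → P (2 * i)) + P (4 * n ∸ 1) ≡ B n + r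
theorem9p4 B enum (suc j) _ r bal = begin
  sumFrom (λ i → P (2 * i)) 1 (2 * suc j ∸ 1) + P (4 * suc j ∸ 1)
    ≡⟨ cong₂ (λ k l → sumFrom (λ i → P (2 * i)) 1 (k ∸ 1) + P (l ∸ 1)) (*-suc 2 j) (*-suc 4 j) ⟩
  sumFrom (λ i → P (2 * i)) 1 (1 + 2 * j) + P (3 + 4 * j)
    ≡⟨ pell-sum≡neoBC+neoBCr j ⟩
  neoBC j + neoBCr j
    ≡⟨ cong₂ _+_ B≡neoBC (neoBC-balancer-unique j (subst (λ m → NeoBalcobalancer m r) B≡neoBC bal))
     ⟨
  B (suc j) + r
    ∎
  where
  open ≡-Reasoning
  B≡neoBC : B (suc j) ≡ neoBC j
  B≡neoBC = enumeration≡neoBC enum j
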